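{- Let $D$ be a tight lune-free link graph, and let $G$ be a simple connected plane graph whose medial graph $m(G)$ equals $D$. Then $G$ is either a cubic graph, a sphere triangulation, or a wheel.
   Context: A link graph is a connected $4$-regular plane graph; it is lune-free if it has no loops and no multiple edges, and tight if for every pair of adjacent faces (sharing an edge) at least one of them has exactly $3$ edges on its boundary. The medial graph $m(G)$ of a plane graph $G$ is the $4$-regular plane graph whose vertices correspond to the edges of $G$, with an edge joining two of them for each pair of edges of $G$ consecutive on the boundary of a common face of $G$. Cubic: every vertex has degree $3$; sphere triangulation: every face has exactly $3$ edges; a wheel is a cycle of $n\ge 3$ vertices plus a central vertex adjacent to all of them. -}

module Defs where

open import Data.Nat using (ℕ; zero; suc; _+_; _*_; _≤_; _<_)
open import Data.Fin using (Fin; toℕ) renaming (zero to fzero; suc to fsuc)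
open import Data.Product using (Σ; ∃; ∃-syntax; _×_; _,_)
open import Data.Sum using (_⊎_)
open import Data.Unit using (⊤)
open import Data.Empty using (⊥)
open import Relation.Binary.PropositionalEquality using (_≡_; _≢_)
open import Relation.Binary.Construct.Closure.ReflexiveTransitive using (Star)
open import Function.Bundles using (_↔_; _⇔_; Inverse)

iter : ∀ {A : Set} → (A → A) → ℕ → A → A
iter f zero    x = x
iter f (suc k) x = f (iter f k x)

-- Plane graphs as combinatorial maps (rotation systems).
-- Darts = half-edges, Fin d.  σ = counter-clockwise rotation of darts
-- around their vertex (a permutation, with inverse σ⁻), α = the
-- fixed-point-free involution sending a dart to the other half of its edge.
-- Vertices = σ-orbits, edges = α-orbits, faces = φ-orbits, φ = σ ∘ α.

record Map : Set where
  field
    d   : ℕ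
    σ   : Fin d → Fin d
    σ⁻  : Fin d → Fin d
    α   : Fin d → Fin d
    σσ⁻ : ∀ x → σ (σ⁻ x) ≡ x
    σ⁻σ : ∀ x → σ⁻ (σ x) ≡ x
    αα  : ∀ x → α (α x) ≡ x
    αfree : ∀ x → α x ≢ x

  φ : Fin d → Fin d
  φ x = σ (α x)

open Map public

SameOrbit : ∀ {n} → (Fin n → Fin n) → Fin n → Fin n → Set
SameOrbit f x y = ∃[ k ] iter f k x ≡ y

OrbitLen : ∀ {n} → (Fin n → Fin n) → Fin n → ℕ → Set
OrbitLen f x k = (1 ≤ k) × (iter f k x ≡ x) × (∀ j → 1 ≤ j → j < k → iter f j x ≢ x)

NumOrbits : ∀ {n} → (Fin n → Fin n) → ℕ → Set
NumOrbits {n} f k =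
  Σ (Fin k → Fin n) λ r →
    (∀ i j → SameOrbit f (r i) (r j) → i ≡ j) × (∀ x → ∃[ i ] SameOrbit f (r i) x)

Step : (M : Map) → Fin (d M) → Fin (d M) → Set
Step M x y = (y ≡ σ M x) ⊎ (y ≡ α M x)

Connected : Map → Set
Connected M = ∀ x y → Star (Step M) x y

Spherical : Map → Set
Spherical M = ∃[ V ] ∃[ E ] ∃[ F ]
  NumOrbits (σ M) V × NumOrbits (α M) E × NumOrbits (φ M) F × (V + F ≡ E + 2)

PlaneGraph : Map → Set
PlaneGraph M = Connected M × Spherical M

LoopFree : Map → Set
LoopFree M = ∀ x → ¬' (SameOrbit (σ M) x (α M x))
  where ¬' : Set → Set
        ¬' P = P → ⊥

NoMultiEdges : Map → Set
NoMultiEdges M = ∀ x y → y ≢ x → y ≢ α M x →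
  SameOrbit (σ M) x y → SameOrbit (σ M) (α M x) (α M y) → ⊥

Simple : Map → Set
Simple M = LoopFree M × NoMultiEdges M

LinkGraph : Map → Set
LinkGraph M = PlaneGraph M × (∀ x → OrbitLen (σ M) x 4)

LuneFree : Map → Set
LuneFree M = Simple M

-- tight: of the two faces on the sides of any edge, one is a triangle
Tight : Map → Set
Tight M = ∀ x → OrbitLen (φ M) x 3 ⊎ OrbitLen (φ M) (α M x) 3

-- Darts of m(G) are pairs (x , b), x a dart of G, b : Fin 2.
-- (x , 0) : at the medial vertex of edge x, along the medial edge of the
--           corner (x , σ x);  (x , 1) : along the corner (σ⁻ x , x).

medialσ : (G : Map) → Fin (d G) × Fin 2 → Fin (d G) × Fin 2
medialσ G (x , fzero)      = (x , fsuc fzero)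
medialσ G (x , fsuc _)     = (α G x , fzero)

medialα : (G : Map) → Fin (d G) × Fin 2 → Fin (d G) × Fin 2
medialα G (x , fzero)      = (σ G x , fsuc fzero)
medialα G (x , fsuc _)     = (σ⁻ G x , fzero)

IsMedialOf : Map → Map → Set
IsMedialOf D G =
  Σ ((Fin (d G) × Fin 2) ↔ Fin (d D)) λ ψ →
    (∀ p → Inverse.to ψ (medialσ G p) ≡ σ D (Inverse.to ψ p)) ×
    (∀ p → Inverse.to ψ (medialα G p) ≡ α D (Inverse.to ψ p))

Cubic : Map → Set
Cubic M = ∀ x → OrbitLen (σ M) x 3

Triangulation : Map → Set
Triangulation M = ∀ x → OrbitLen (φ M) x 3

-- wheel W_n on Fin (suc n): vertex 0 is the hub, fsuc i (i : Fin n) rim vertices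
NextRim : (n : ℕ) → Fin n → Fin n → Set
NextRim n i j = (suc (toℕ i) ≡ toℕ j) ⊎ ((suc (toℕ i) ≡ n) × (toℕ j ≡ 0))

WheelAdj : (n : ℕ) → Fin (suc n) → Fin (suc n) → Set
WheelAdj n fzero    fzero    = ⊥
WheelAdj n fzero    (fsuc j) = ⊤
WheelAdj n (fsuc i) fzero    = ⊤
WheelAdj n (fsuc i) (fsuc j) = NextRim n i j ⊎ NextRim n j i

-- the underlying graph of M is isomorphic to the wheel W_n:
-- f maps darts to wheel vertices, identifying exactly darts at the same
-- vertex (so it induces a bijection of vertex sets), and edges of M
-- correspond to edges of W_n.
IsoToWheel : Map → ℕ → Set
IsoToWheel M n =
  Σ (Fin (d M) → Fin (suc n)) λ f →
    (∀ x y → (f x ≡ f y) ⇔ SameOrbit (σ M) x y) ×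
    (∀ v → ∃[ x ] f x ≡ v) ×
    (∀ x → WheelAdj n (f x) (f (α M x))) ×
    (∀ i j → WheelAdj n i j → ∃[ x ] (f x ≡ i × f (α M x) ≡ j))

Wheel : Map → Set
Wheel M = ∃[ n ] (3 ≤ n × IsoToWheel M n)

{-# OPTIONS --safe #-}
module Submission where

open import Defs
open import Data.Empty using (⊥; ⊥-elim)
open import Data.Fin using (Fin; toℕ) renaming (zero to fzero; suc to fsuc)
open import Data.Fin.Patterns using (0F; 1F)
import Data.Fin.Properties as Fin
open import Data.Nat using (ℕ; zero; suc; _+_; _*_; _∸_; _≤_; _<_; _≤?_; z≤n; s≤s; NonZero)
open import Data.Nat.DivMod
open import Data.Nat.Induction using (<-rec)
open import Data.Nat.Properties
open import Data.Product using (∃; _×_; _,_; proj₁; proj₂)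
open import Data.Sum using (_⊎_; inj₁; inj₂)
open import Data.Unit using (tt)
open import Function.Base using (_∘_)
open import Function.Bundles using (Inverse; Injection; _↔_; _⇔_; mk⇔)
open import Function.Definitions using (Injective)
open import Function.Properties.Inverse using (↔⇒↣)
open import Relation.Binary.Construct.Closure.ReflexiveTransitive using (Star; ε; _◅_)
open import Relation.Binary.Definitions using (tri<; tri≈; tri>)
open import Relation.Binary.PropositionalEquality
open import Relation.Nullary using (¬_; yes; no)
open import Relation.Nullary.Decidable using (_×-dec_; ¬?; decidable-stable)
open import Relation.Unary using (Decidable)

-- The faces of m(G) through the darts (x , 1) are the vertices of G, those through (x , 0)
-- the faces of G, and every edge of m(G) has one of each kind on its two sides.  So D being
-- tight says that every dart of G lies at a vertex of degree 3 or on a triangle, and D being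
-- lune-free excludes vertices of degree 1 and 2 in G.
--
-- Suppose G is not cubic.  All faces around a vertex of degree ≠ 3 are triangles.  Call a dart
-- from such a vertex to a vertex u of degree 3 a spoke; two of the three faces at u then contain
-- the spoke's tail.  If the third face at u is a triangle for every spoke, then the darts at or
-- next to vertices of degree ≠ 3 are closed under σ and α, so by connectivity every dart lies on
-- a triangle.  Otherwise, the non-triangular third face of one spoke is passed on to the next
-- spoke around the same hub; hence all neighbours of the hub have degree 3 and consecutive ones
-- are adjacent, which (G being connected and simple) makes G a wheel.

iter-+ : ∀ {A : Set} (f : A → A) i j x → iter f (i + j) x ≡ iter f i (iter f j x)
iter-+ f zero    j x = refl
iter-+ f (suc i) j x = cong f (iter-+ f i j x)

iter-injective : ∀ {A : Set} {f : A → A} → Injective _≡_ _≡_ f → ∀ k → Injective _≡_ _≡_ (iter f k)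
iter-injective inj zero    e = e
iter-injective inj (suc k) e = iter-injective inj k (inj e)

module _ {A : Set} (f : A → A) {x : A} {n : ℕ} (fⁿx≡x : iter f n x ≡ x) where

  iter-period-* : ∀ q → iter f (q * n) x ≡ x
  iter-period-* zero    = refl
  iter-period-* (suc q) = begin
    iter f (n + q * n) x         ≡⟨ iter-+ f n (q * n) x ⟩
    iter f n (iter f (q * n) x)  ≡⟨ cong (iter f n) (iter-period-* q) ⟩
    iter f n x                   ≡⟨ fⁿx≡x ⟩
    x                            ∎
    where open ≡-Reasoning

  iter-period-% : .{{_ : NonZero n}} → ∀ k → iter f k x ≡ iter f (k % n) x
  iter-period-% k = begin
    iter f k x                                ≡⟨ cong (λ t → iter f t x) (m≡m%n+[m/n]*n k n) ⟩
    iter f (k % n + k / n * n) x              ≡⟨ iter-+ f (k % n) (k / n * n) x ⟩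
    iter f (k % n) (iter f (k / n * n) x)     ≡⟨ cong (iter f (k % n)) (iter-period-* (k / n)) ⟩
    iter f (k % n) x                          ∎
    where open ≡-Reasoning

SameOrbit-trans : ∀ {n} {f : Fin n → Fin n} {x y z} →
                  SameOrbit f x y → SameOrbit f y z → SameOrbit f x z
SameOrbit-trans {f = f} {x} (i , refl) (j , refl) = j + i , iter-+ f j i x

SameOrbit-sym : ∀ {n} {f : Fin n → Fin n} {x y} m → iter f (suc m) x ≡ x →
                SameOrbit f x y → SameOrbit f y x
SameOrbit-sym {f = f} {x} m fⁿx≡x (k , refl) = k * m , (begin
  iter f (k * m) (iter f k x)  ≡⟨ iter-+ f (k * m) k x ⟨
  iter f (k * m + k) x         ≡⟨ cong (λ t → iter f t x) (+-comm (k * m) k) ⟩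
  iter f (k + k * m) x         ≡⟨ cong (λ t → iter f t x) (*-suc k m) ⟨
  iter f (k * suc m) x         ≡⟨ iter-period-* f fⁿx≡x k ⟩
  x                            ∎)
  where open ≡-Reasoning

leastWitness : ∀ {P : ℕ → Set} → Decidable P → ∀ {p} → P p →
               ∃ λ m → P m × (∀ {j} → j < m → ¬ P j)
leastWitness {P} P? {p} = <-rec Least step p
  where
  Least : ℕ → Set
  Least p = P p → ∃ λ m → P m × (∀ {j} → j < m → ¬ P j)
  step : ∀ p → (∀ {j} → j < p → Least j) → Least p
  step p below Pp with anyUpTo? P? p
  ... | yes (j , j<p , Pj) = below j<p Pj
  ... | no none            = p , Pp , λ j<p Pj → none (_ , j<p , Pj)

module _ {n} {f : Fin n → Fin n} (f-injective : Injective _≡_ _≡_ f) where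

  iter-return : ∀ {x i j} → i < j → iter f i x ≡ iter f j x → iter f (j ∸ i) x ≡ x
  iter-return {x} {i} {j} i<j fⁱx≡fʲx = iter-injective f-injective i (begin
    iter f i (iter f (j ∸ i) x)  ≡⟨ iter-+ f i (j ∸ i) x ⟨
    iter f (i + (j ∸ i)) x       ≡⟨ cong (λ t → iter f t x) (m+[n∸m]≡n (<⇒≤ i<j)) ⟩
    iter f j x                   ≡⟨ fⁱx≡fʲx ⟨
    iter f i x                   ∎)
    where open ≡-Reasoning

  orbitLength : ∀ x → ∃ (OrbitLen f x)
  orbitLength x with Fin.pigeonhole (n<1+n n) (λ (k : Fin (suc n)) → iter f (toℕ k) x)
  ... | i , j , i<j , fⁱx≡fʲx
    with leastWitness (λ k → (1 ≤? k) ×-dec (iter f k x Fin.≟ x))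
                      (m<n⇒0<n∸m i<j , iter-return i<j fⁱx≡fʲx)
  ... | m , (1≤m , fᵐx≡x) , minimal =
    m , 1≤m , fᵐx≡x , λ k 1≤k k<m fᵏx≡x → minimal k<m (1≤k , fᵏx≡x)

  OrbitLen-injective : ∀ {x m i j} → OrbitLen f x m → i < m → j < m →
                       iter f i x ≡ iter f j x → i ≡ j
  OrbitLen-injective {x} {m} {i} {j} (_ , _ , minimal) i<m j<m fⁱx≡fʲx with <-cmp i j
  ... | tri< i<j _ _ = ⊥-elim (minimal (j ∸ i) (m<n⇒0<n∸m i<j) (≤-<-trans (m∸n≤m j i) j<m)
                                       (iter-return i<j fⁱx≡fʲx))
  ... | tri≈ _ i≡j _ = i≡j
  ... | tri> _ _ j<i = ⊥-elim (minimal (i ∸ j) (m<n⇒0<n∸m j<i) (≤-<-trans (m∸n≤m i j) i<m)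
                                       (iter-return j<i (sym fⁱx≡fʲx)))

Period3 : ∀ {A : Set} → (A → A) → A → Set
Period3 f x = (f (f (f x)) ≡ x) × (f x ≢ x) × (f (f x) ≢ x)

period3? : ∀ {n} (f : Fin n → Fin n) → Decidable (Period3 f)
period3? f x = (f (f (f x)) Fin.≟ x) ×-dec ¬? (f x Fin.≟ x) ×-dec ¬? (f (f x) Fin.≟ x)

Period3⇒OrbitLen : ∀ {n} {f : Fin n → Fin n} {x} → Period3 f x → OrbitLen f x 3
Period3⇒OrbitLen (f³x≡x , fx≢x , f²x≢x) = s≤s z≤n , f³x≡x , λ where
  1 _ _ → fx≢x
  2 _ _ → f²x≢x
  (suc (suc (suc _))) _ (s≤s (s≤s (s≤s ())))

OrbitLen⇒Period3 : ∀ {n} {f : Fin n → Fin n} {x} → OrbitLen f x 3 → Period3 f x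
OrbitLen⇒Period3 (_ , f³x≡x , minimal) =
  f³x≡x , minimal 1 ≤-refl (s≤s (s≤s z≤n)) , minimal 2 (s≤s z≤n) ≤-refl

OrbitLen⇒3≤ : ∀ {n} {f : Fin n → Fin n} {x m} → f x ≢ x → f (f x) ≢ x → OrbitLen f x m → 3 ≤ m
OrbitLen⇒3≤ {m = 1} fx≢x _ (_ , fx≡x , _) = ⊥-elim (fx≢x fx≡x)
OrbitLen⇒3≤ {m = 2} _ f²x≢x (_ , f²x≡x , _) = ⊥-elim (f²x≢x f²x≡x)
OrbitLen⇒3≤ {m = suc (suc (suc _))} _ _ _ = s≤s (s≤s (s≤s z≤n))

module _ {A : Set} {f : A → A} where

  Period3-step : Injective _≡_ _≡_ f → ∀ {x} → Period3 f x → Period3 f (f x)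
  Period3-step f-injective (f³x≡x , fx≢x , _) =
    cong f f³x≡x , fx≢x ∘ f-injective , λ f³x≡fx → fx≢x (trans (sym f³x≡fx) f³x≡x)

  Period3-inverse : ∀ {g : A → A} → (∀ x → f (g x) ≡ x) → (∀ x → g (f x) ≡ x) →
                    ∀ {x} → Period3 g x → Period3 f x
  Period3-inverse {g} fg gf {x} (g³x≡x , gx≢x , g²x≢x) = f³x≡x , fx≢x , f²x≢x
    where
    f³x≡x : f (f (f x)) ≡ x
    f³x≡x = begin
      f (f (f x))              ≡⟨ cong (f ∘ f ∘ f) g³x≡x ⟨
      f (f (f (g (g (g x)))))  ≡⟨ cong (f ∘ f) (fg _) ⟩
      f (f (g (g x)))          ≡⟨ cong f (fg _) ⟩
      f (g x)                  ≡⟨ fg x ⟩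
      x                        ∎
      where open ≡-Reasoning
    fx≢x : f x ≢ x
    fx≢x fx≡x = gx≢x (trans (cong g (sym fx≡x)) (gf x))
    f²x≢x : f (f x) ≢ x
    f²x≢x f²x≡x = g²x≢x (trans (cong (g ∘ g) (sym f²x≡x)) (trans (cong g (gf _)) (gf x)))

  Period3-reflect : ∀ {B : Set} {g : B → B} {h : A → B} → Injective _≡_ _≡_ h →
                    (∀ z → h (f z) ≡ g (h z)) → ∀ {z} → Period3 g (h z) → Period3 f z
  Period3-reflect {g = g} {h} h-injective hf≡gh {z} (g³hz≡hz , ghz≢hz , g²hz≢hz) =
    h-injective (trans hf³ g³hz≡hz) ,
    (λ fz≡z → ghz≢hz (trans (sym (hf≡gh z)) (cong h fz≡z))) ,
    (λ f²z≡z → g²hz≢hz (trans (sym hf²) (cong h f²z≡z)))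
    where
    hf² : h (f (f z)) ≡ g (g (h z))
    hf² = trans (hf≡gh _) (cong g (hf≡gh z))
    hf³ : h (f (f (f z))) ≡ g (g (g (h z)))
    hf³ = trans (hf≡gh _) (cong g hf²)

  Period3-unstep : Injective _≡_ _≡_ f → ∀ {x} → Period3 f (f x) → Period3 f x
  Period3-unstep f-injective = Period3-reflect {g = f} f-injective (λ _ → refl)

Degree3 : (M : Map) → Fin (d M) → Set
Degree3 M = Period3 (σ M)

OnTriangle : (M : Map) → Fin (d M) → Set
OnTriangle M = Period3 (φ M)

module _ (M : Map) where

  σ-injective : Injective _≡_ _≡_ (σ M)
  σ-injective {x} {y} σx≡σy = trans (sym (σ⁻σ M x)) (trans (cong (σ⁻ M) σx≡σy) (σ⁻σ M y))

  σ⁻-injective : Injective _≡_ _≡_ (σ⁻ M)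
  σ⁻-injective {x} {y} σ⁻x≡σ⁻y = trans (sym (σσ⁻ M x)) (trans (cong (σ M) σ⁻x≡σ⁻y) (σσ⁻ M y))

  α-injective : Injective _≡_ _≡_ (α M)
  α-injective {x} {y} αx≡αy = trans (sym (αα M x)) (trans (cong (α M) αx≡αy) (αα M y))

  φ-injective : Injective _≡_ _≡_ (φ M)
  φ-injective = α-injective ∘ σ-injective

  Connected-induction : Connected M → {P : Fin (d M) → Set} →
                        (∀ {x} → P x → P (σ M x)) → (∀ {x} → P x → P (α M x)) →
                        ∀ {x} → P x → ∀ y → P y
  Connected-induction connected {P} Pσ Pα {x} Px y = transport (connected x y) Px
    where
    transport : ∀ {x y} → Star (Step M) x y → P x → P y
    transport ε                = λ Px → Px
    transport (inj₁ refl ◅ xs) = transport xs ∘ Pσ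
    transport (inj₂ refl ◅ xs) = transport xs ∘ Pα

  Degree3[σ⁻x]⇒Degree3[x] : ∀ {x} → Degree3 M (σ⁻ M x) → Degree3 M x
  Degree3[σ⁻x]⇒Degree3[x] deg3 = subst (Degree3 M) (σσ⁻ M _) (Period3-step σ-injective deg3)

  Degree3⇒σ⁻≡σσ : ∀ {x} → Degree3 M x → σ⁻ M x ≡ σ M (σ M x)
  Degree3⇒σ⁻≡σσ (σ³x≡x , _) = trans (cong (σ⁻ M) (sym σ³x≡x)) (σ⁻σ M _)

  OnTriangle⇒ασα≡σ⁻ασ⁻ : ∀ {y} → OnTriangle M y → α M (σ M (α M y)) ≡ σ⁻ M (α M (σ⁻ M y))
  OnTriangle⇒ασα≡σ⁻ασ⁻ {y} (φ³y≡y , _) = begin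
    α M (σ M (α M y))                                 ≡⟨ σ⁻σ M _ ⟨
    σ⁻ M (σ M (α M (σ M (α M y))))                    ≡⟨ cong (σ⁻ M) (αα M _) ⟨
    σ⁻ M (α M (α M (σ M (α M (σ M (α M y))))))        ≡⟨ cong (σ⁻ M ∘ α M) (σ⁻σ M _) ⟨
    σ⁻ M (α M (σ⁻ M (φ M (φ M (φ M y)))))             ≡⟨ cong (σ⁻ M ∘ α M ∘ σ⁻ M) φ³y≡y ⟩
    σ⁻ M (α M (σ⁻ M y))                               ∎
    where open ≡-Reasoning

  ασασ≡σσα : ∀ {y} → OnTriangle M (σ M y) → Degree3 M (α M y) →
             α M (σ M (α M (σ M y))) ≡ σ M (σ M (α M y))
  ασασ≡σσα {y} σy-triangle αy-degree3 = begin
    α M (σ M (α M (σ M y)))    ≡⟨ OnTriangle⇒ασα≡σ⁻ασ⁻ σy-triangle ⟩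
    σ⁻ M (α M (σ⁻ M (σ M y)))  ≡⟨ cong (σ⁻ M ∘ α M) (σ⁻σ M y) ⟩
    σ⁻ M (α M y)               ≡⟨ Degree3⇒σ⁻≡σσ αy-degree3 ⟩
    σ M (σ M (α M y))          ∎
    where open ≡-Reasoning

  data Around (z : Fin (d M)) : Fin (d M) → Set where
    at₀ : Around z z
    at₁ : Around z (σ M z)
    at₂ : Around z (σ M (σ M z))

  Around-σ : ∀ {z x} → Degree3 M z → Around z x → Around z (σ M x)
  Around-σ _              at₀ = at₁
  Around-σ _              at₁ = at₂
  Around-σ (σ³z≡z , _) at₂ = subst (Around _) (sym σ³z≡z) at₀

  Around⇒Degree3 : ∀ {z x} → Around z x → Degree3 M x → Degree3 M z
  Around⇒Degree3 at₀ = λ deg3 → deg3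
  Around⇒Degree3 at₁ = Period3-unstep σ-injective
  Around⇒Degree3 at₂ = Period3-unstep σ-injective ∘ Period3-unstep σ-injective

  Around⇒SameOrbit : ∀ {z x} → Around z x → SameOrbit (σ M) z x
  Around⇒SameOrbit at₀ = 0 , refl
  Around⇒SameOrbit at₁ = 1 , refl
  Around⇒SameOrbit at₂ = 2 , refl

  Around⇒SameOrbit⁻ : ∀ {z x} → Degree3 M z → Around z x → SameOrbit (σ M) x z
  Around⇒SameOrbit⁻ (σ³z≡z , _) at = SameOrbit-sym 2 σ³z≡z (Around⇒SameOrbit at)

module Medial (D G : Map) (medial : IsMedialOf D G) where

  private
    ψ : (Fin (d G) × Fin 2) ↔ Fin (d D)
    ψ = proj₁ medial
    σ-hom : ∀ p → Inverse.to ψ (medialσ G p) ≡ σ D (Inverse.to ψ p)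
    σ-hom = proj₁ (proj₂ medial)
    α-hom : ∀ p → Inverse.to ψ (medialα G p) ≡ α D (Inverse.to ψ p)
    α-hom = proj₂ (proj₂ medial)

  corner : Fin 2 → Fin (d G) → Fin (d D)
  corner b x = Inverse.to ψ (x , b)

  corner-injective : ∀ b → Injective _≡_ _≡_ (corner b)
  corner-injective b = cong proj₁ ∘ Injection.injective (↔⇒↣ ψ)

  σ-corner₀ : ∀ x → σ D (corner 0F x) ≡ corner 1F x
  σ-corner₀ x = sym (σ-hom (x , 0F))

  σ-corner₁ : ∀ x → σ D (corner 1F x) ≡ corner 0F (α G x)
  σ-corner₁ x = sym (σ-hom (x , 1F))

  φ-corner₁ : ∀ x → φ D (corner 1F x) ≡ corner 1F (σ⁻ G x)
  φ-corner₁ x = trans (cong (σ D) (sym (α-hom (x , 1F)))) (σ-corner₀ (σ⁻ G x))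

  φ-corner₀ : ∀ x → φ D (corner 0F x) ≡ corner 0F (α G (σ G x))
  φ-corner₀ x = trans (cong (σ D) (sym (α-hom (x , 0F)))) (σ-corner₁ (σ G x))

  Period3[φ-corner₁]⇒Degree3 : ∀ {x} → Period3 (φ D) (corner 1F x) → Degree3 G x
  Period3[φ-corner₁]⇒Degree3 =
    Period3-inverse {f = σ G} {g = σ⁻ G} (σσ⁻ G) (σ⁻σ G) ∘
    Period3-reflect {f = σ⁻ G} {g = φ D} (corner-injective 1F) (sym ∘ φ-corner₁)

  Period3[φ-corner₀]⇒OnTriangle : ∀ {x} → Period3 (φ D) (corner 0F (σ⁻ G x)) → OnTriangle G x
  Period3[φ-corner₀]⇒OnTriangle =
    Period3-reflect {f = φ G} {g = α G ∘ σ G} (σ⁻-injective G) σ⁻φ≡ασσ⁻ ∘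
    Period3-reflect {f = α G ∘ σ G} {g = φ D} (corner-injective 0F) (sym ∘ φ-corner₀)
    where
    σ⁻φ≡ασσ⁻ : ∀ z → σ⁻ G (φ G z) ≡ α G (σ G (σ⁻ G z))
    σ⁻φ≡ασσ⁻ z = trans (σ⁻σ G _) (cong (α G) (sym (σσ⁻ G z)))

  Tight⇒Degree3⊎OnTriangle : Tight D → ∀ x → Degree3 G x ⊎ OnTriangle G x
  Tight⇒Degree3⊎OnTriangle tight x with tight (corner 1F x)
  ... | inj₁ vertexFace = inj₁ (Period3[φ-corner₁]⇒Degree3 (OrbitLen⇒Period3 vertexFace))
  ... | inj₂ faceFace   = inj₂ (Period3[φ-corner₀]⇒OnTriangle
    (subst (Period3 (φ D)) (sym (α-hom (x , 1F))) (OrbitLen⇒Period3 faceFace)))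

  LuneFree⇒σ≢id : LuneFree D → ∀ x → σ G x ≢ x
  LuneFree⇒σ≢id (loopFree , _) x σx≡x = loopFree (corner 0F x) (1 , (begin
    σ D (corner 0F x)  ≡⟨ σ-corner₀ x ⟩
    corner 1F x        ≡⟨ cong (corner 1F) σx≡x ⟨
    corner 1F (σ G x)  ≡⟨ α-hom (x , 0F) ⟩
    α D (corner 0F x)  ∎))
    where open ≡-Reasoning

  -- Both corners at a vertex of degree 2 join the medial vertices of its two edges.
  LuneFree⇒σσ≢id : LuneFree D → ∀ x → σ G (σ G x) ≢ x
  LuneFree⇒σσ≢id luneFree@(_ , noMultiEdges) x σσx≡x =
    noMultiEdges X Y Y≢X Y≢αX (1 , σ-corner₀ x) (3 , σ³αX≡αY)
    where
    X Y : Fin (d D)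
    X = corner 0F x
    Y = corner 1F x
    Y≢X : Y ≢ X
    Y≢X Y≡X with cong proj₂ (Injection.injective (↔⇒↣ ψ) Y≡X)
    ... | ()
    Y≢αX : Y ≢ α D X
    Y≢αX Y≡αX = LuneFree⇒σ≢id luneFree x
      (sym (corner-injective 1F (trans Y≡αX (sym (α-hom (x , 0F))))))
    σ⁻x≡σx : σ⁻ G x ≡ σ G x
    σ⁻x≡σx = trans (cong (σ⁻ G) (sym σσx≡x)) (σ⁻σ G _)
    σ³αX≡αY : σ D (σ D (σ D (α D X))) ≡ α D Y
    σ³αX≡αY = begin
      σ D (σ D (σ D (α D X)))                ≡⟨ cong (σ D ∘ σ D ∘ σ D) (α-hom (x , 0F)) ⟨
      σ D (σ D (σ D (corner 1F (σ G x))))    ≡⟨ cong (σ D ∘ σ D) (σ-corner₁ (σ G x)) ⟩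
      σ D (σ D (corner 0F (α G (σ G x))))    ≡⟨ cong (σ D) (σ-corner₀ _) ⟩
      σ D (corner 1F (α G (σ G x)))          ≡⟨ σ-corner₁ _ ⟩
      corner 0F (α G (α G (σ G x)))          ≡⟨ cong (corner 0F) (αα G _) ⟩
      corner 0F (σ G x)                      ≡⟨ cong (corner 0F) σ⁻x≡σx ⟨
      corner 0F (σ⁻ G x)                     ≡⟨ α-hom (x , 1F) ⟩
      α D Y                                  ∎
      where open ≡-Reasoning

module _ (n : ℕ) .{{_ : NonZero n}} where

  toℕ-mod : ∀ k → toℕ (k mod n) ≡ k % n
  toℕ-mod k = Fin.toℕ-fromℕ< (m%n<n k n)

  toℕ-mod-toℕ : ∀ (i : Fin n) → toℕ i mod n ≡ i
  toℕ-mod-toℕ i = Fin.toℕ-injective (trans (toℕ-mod (toℕ i)) (m<n⇒m%n≡m (Fin.toℕ<n i)))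

  suc-% : ∀ k → suc k % n ≡ suc (k % n) % n
  suc-% k = begin
    (1 + k) % n                  ≡⟨ %-distribˡ-+ 1 k n ⟩
    (1 % n + k % n) % n          ≡⟨ cong (λ t → (1 % n + t) % n) (m%n%n≡m%n k n) ⟨
    (1 % n + k % n % n) % n      ≡⟨ %-distribˡ-+ 1 (k % n) n ⟨
    (1 + k % n) % n              ∎
    where open ≡-Reasoning

  NextRim-mod : ∀ k → NextRim n (k mod n) (suc k mod n)
  NextRim-mod k with m≤n⇒m<n∨m≡n (m%n<n k n)
  ... | inj₁ 1+k%n<n = inj₁ (begin
    suc (toℕ (k mod n))  ≡⟨ cong suc (toℕ-mod k) ⟩
    suc (k % n)          ≡⟨ m<n⇒m%n≡m 1+k%n<n ⟨
    suc (k % n) % n      ≡⟨ suc-% k ⟨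
    suc k % n            ≡⟨ toℕ-mod (suc k) ⟨
    toℕ (suc k mod n)    ∎)
    where open ≡-Reasoning
  ... | inj₂ 1+k%n≡n = inj₂ (trans (cong suc (toℕ-mod k)) 1+k%n≡n , (begin
    toℕ (suc k mod n)    ≡⟨ toℕ-mod (suc k) ⟩
    suc k % n            ≡⟨ suc-% k ⟩
    suc (k % n) % n      ≡⟨ cong (_% n) 1+k%n≡n ⟩
    n % n                ≡⟨ n%n≡0 n ⟩
    0                    ∎))
    where open ≡-Reasoning

  NextRim⇒suc-mod : ∀ {i j} → NextRim n i j → suc (toℕ i) mod n ≡ j
  NextRim⇒suc-mod {i} {j} (inj₁ 1+i≡j) = Fin.toℕ-injective
    (trans (toℕ-mod _) (trans (cong (_% n) 1+i≡j) (m<n⇒m%n≡m (Fin.toℕ<n j))))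
  NextRim⇒suc-mod {i} {j} (inj₂ (1+i≡n , j≡0)) = Fin.toℕ-injective
    (trans (toℕ-mod _) (trans (cong (_% n) 1+i≡n) (trans (n%n≡0 n) (sym j≡0))))

module DegreeOrTriangle (G : Map) (degree3⊎triangle : ∀ x → Degree3 G x ⊎ OnTriangle G x) where

  ¬Degree3⇒OnTriangle : ∀ {x} → ¬ Degree3 G x → OnTriangle G x
  ¬Degree3⇒OnTriangle {x} ¬deg3 with degree3⊎triangle x
  ... | inj₁ deg3 = ⊥-elim (¬deg3 deg3)
  ... | inj₂ tri  = tri

  ¬Degree3-σ : ∀ {x} → ¬ Degree3 G x → ¬ Degree3 G (σ G x)
  ¬Degree3-σ ¬deg3 = ¬deg3 ∘ Period3-unstep (σ-injective G)

  Spoke : Fin (d G) → Set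
  Spoke y = ¬ Degree3 G y × Degree3 G (α G y)

  -- For a spoke y, farDart y lies on the face at the vertex of α y that avoids the vertex of y.
  farDart : Fin (d G) → Fin (d G)
  farDart y = σ G (σ G (α G y))

  module _ (connected : Connected G)
           (farTriangle : ∀ {y} → Spoke y → OnTriangle G (farDart y)) where

    Near¬Degree3 : Fin (d G) → Set
    Near¬Degree3 x = ¬ Degree3 G x ⊎ ∃ λ y → Spoke y × Around G (α G y) x

    Near¬Degree3-σ : ∀ {x} → Near¬Degree3 x → Near¬Degree3 (σ G x)
    Near¬Degree3-σ (inj₁ ¬deg3)                      = inj₁ (¬Degree3-σ ¬deg3)
    Near¬Degree3-σ (inj₂ (y , spoke@(_ , deg3) , at)) = inj₂ (y , spoke , Around-σ G deg3 at)

    Near¬Degree3-α : ∀ {x} → Near¬Degree3 x → Near¬Degree3 (α G x)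
    Near¬Degree3-α {x} near with period3? (σ G) (α G x)
    ... | no ¬deg3 = inj₁ ¬deg3
    ... | yes deg3 = inj₂ (neighbour near)
      where
      neighbour : Near¬Degree3 x → ∃ λ y → Spoke y × Around G (α G y) (α G x)
      neighbour (inj₁ ¬deg3) = x , (¬deg3 , deg3) , at₀
      neighbour (inj₂ (y , (¬deg3 , _) , at₀)) = ⊥-elim (¬deg3 (subst (Degree3 G) (αα G y) deg3))
      neighbour (inj₂ (y , (¬deg3 , _) , at₁)) =
        σ⁻ G y , (¬deg3 ∘ Degree3[σ⁻x]⇒Degree3[x] G , deg3′) ,
        subst (Around G _) (sym ασαy≡σσασ⁻y) at₂
        where
        ασαy≡σ⁻ασ⁻y : α G (σ G (α G y)) ≡ σ⁻ G (α G (σ⁻ G y))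
        ασαy≡σ⁻ασ⁻y = OnTriangle⇒ασα≡σ⁻ασ⁻ G (¬Degree3⇒OnTriangle ¬deg3)
        deg3′ : Degree3 G (α G (σ⁻ G y))
        deg3′ = Degree3[σ⁻x]⇒Degree3[x] G (subst (Degree3 G) ασαy≡σ⁻ασ⁻y deg3)
        ασαy≡σσασ⁻y : α G (σ G (α G y)) ≡ σ G (σ G (α G (σ⁻ G y)))
        ασαy≡σσασ⁻y = trans ασαy≡σ⁻ασ⁻y (Degree3⇒σ⁻≡σσ G deg3′)
      neighbour (inj₂ (y , (¬deg3 , deg3αy) , at₂)) =
        σ G y , (¬Degree3-σ ¬deg3 , deg3′) , subst (Around G _) (sym ασσαy≡σασy) at₁
        where
        ασασy≡σσαy : α G (σ G (α G (σ G y))) ≡ farDart y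
        ασασy≡σσαy = ασασ≡σσα G (¬Degree3⇒OnTriangle (¬Degree3-σ ¬deg3)) deg3αy
        ασσαy≡σασy : α G (farDart y) ≡ σ G (α G (σ G y))
        ασσαy≡σασy = trans (cong (α G) (sym ασασy≡σσαy)) (αα G _)
        deg3′ : Degree3 G (α G (σ G y))
        deg3′ = Period3-unstep (σ-injective G) (subst (Degree3 G) ασσαy≡σασy deg3)

    Near¬Degree3⇒OnTriangle : ∀ {x} → Near¬Degree3 x → OnTriangle G x
    Near¬Degree3⇒OnTriangle (inj₁ ¬deg3) = ¬Degree3⇒OnTriangle ¬deg3
    Near¬Degree3⇒OnTriangle (inj₂ (y , (¬deg3 , _) , at₀)) =
      Period3-unstep (φ-injective G)
        (subst (OnTriangle G ∘ σ G) (sym (αα G y)) (¬Degree3⇒OnTriangle (¬Degree3-σ ¬deg3)))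
    Near¬Degree3⇒OnTriangle (inj₂ (y , (¬deg3 , _) , at₁)) =
      Period3-step (φ-injective G) (¬Degree3⇒OnTriangle ¬deg3)
    Near¬Degree3⇒OnTriangle (inj₂ (y , spoke , at₂)) = farTriangle spoke

    triangulation : ∀ {y₀} → ¬ Degree3 G y₀ → Triangulation G
    triangulation ¬deg3 x = Period3⇒OrbitLen (Near¬Degree3⇒OnTriangle
      (Connected-induction G connected {P = Near¬Degree3} Near¬Degree3-σ Near¬Degree3-α
                           (inj₁ ¬deg3) x))

  WheelSpoke : Fin (d G) → Set
  WheelSpoke y = Spoke y × ¬ OnTriangle G (farDart y)

  wheelSpoke? : Decidable WheelSpoke
  wheelSpoke? y =
    (¬? (period3? (σ G) y) ×-dec period3? (σ G) (α G y)) ×-dec ¬? (period3? (φ G) (farDart y))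

  WheelSpoke-σ : ∀ {y} → WheelSpoke y → WheelSpoke (σ G y)
  WheelSpoke-σ {y} ((¬deg3 , deg3αy) , ¬far) = (¬Degree3-σ ¬deg3 , deg3′) , ¬far′
    where
    farDart-σ : farDart (σ G y) ≡ φ G (farDart y)
    farDart-σ = cong (σ G) (trans (sym (αα G _))
      (cong (α G) (ασασ≡σσα G (¬Degree3⇒OnTriangle (¬Degree3-σ ¬deg3)) deg3αy)))
    ¬far′ : ¬ OnTriangle G (farDart (σ G y))
    ¬far′ = ¬far ∘ Period3-unstep (φ-injective G) ∘ subst (OnTriangle G) farDart-σ
    deg3′ : Degree3 G (α G (σ G y))
    deg3′ with degree3⊎triangle (farDart (σ G y))
    ... | inj₁ deg3 = Around⇒Degree3 G at₂ deg3
    ... | inj₂ tri  = ⊥-elim (¬far′ tri)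

  module WheelFromSpoke (connected : Connected G) (simple : Simple G)
                        {y₀} (spoke₀ : WheelSpoke y₀)
                        (m : ℕ) (hub-degree : OrbitLen (σ G) y₀ (suc m)) where

    loopFree : LoopFree G
    loopFree = proj₁ simple

    noMultiEdges : NoMultiEdges G
    noMultiEdges = proj₂ simple

    n : ℕ
    n = suc m

    hub : ℕ → Fin (d G)
    hub k = iter (σ G) k y₀

    rim : ℕ → Fin (d G)
    rim k = α G (hub k)

    hub-spoke : ∀ k → WheelSpoke (hub k)
    hub-spoke zero    = spoke₀
    hub-spoke (suc k) = WheelSpoke-σ (hub-spoke k)

    rim-degree3 : ∀ k → Degree3 G (rim k)
    rim-degree3 k = proj₂ (proj₁ (hub-spoke k))

    hubⁿ≡y₀ : hub n ≡ y₀
    hubⁿ≡y₀ = proj₁ (proj₂ hub-degree)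

    hub-pred : ∀ k → hub (suc (k + m)) ≡ hub k
    hub-pred k = begin
      hub (suc (k + m))     ≡⟨ cong hub (+-suc k m) ⟨
      iter (σ G) (k + n) y₀ ≡⟨ iter-+ (σ G) k n y₀ ⟩
      iter (σ G) k (hub n)  ≡⟨ cong (iter (σ G) k) hubⁿ≡y₀ ⟩
      hub k                 ∎
      where open ≡-Reasoning

    hub-SameOrbit : ∀ k k′ → SameOrbit (σ G) (hub k) (hub k′)
    hub-SameOrbit k k′ = SameOrbit-trans (SameOrbit-sym m hubⁿ≡y₀ (k , refl)) (k′ , refl)

    rimIndex : ℕ → Fin n
    rimIndex k = k mod n

    hub-rimIndex : ∀ k → hub k ≡ hub (toℕ (rimIndex k))
    hub-rimIndex k = trans (iter-period-% (σ G) hubⁿ≡y₀ k) (cong hub (sym (toℕ-mod n k)))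

    hub≡⇒rimIndex≡ : ∀ k k′ → hub k ≡ hub k′ → rimIndex k ≡ rimIndex k′
    hub≡⇒rimIndex≡ k k′ hubk≡hubk′ = Fin.toℕ-injective
      (OrbitLen-injective (σ-injective G) hub-degree (Fin.toℕ<n _) (Fin.toℕ<n _)
        (trans (sym (hub-rimIndex k)) (trans hubk≡hubk′ (hub-rimIndex k′))))

    rimIndex≡⇒hub≡ : ∀ k k′ → rimIndex k ≡ rimIndex k′ → hub k ≡ hub k′
    rimIndex≡⇒hub≡ k k′ eq =
      trans (hub-rimIndex k) (trans (cong (hub ∘ toℕ) eq) (sym (hub-rimIndex k′)))

    rimIndex-pred : ∀ k → rimIndex (suc (k + m)) ≡ rimIndex k
    rimIndex-pred k = hub≡⇒rimIndex≡ (suc (k + m)) k (hub-pred k)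

    rim-edge : ∀ k → α G (σ G (rim (suc k))) ≡ σ G (σ G (rim k))
    rim-edge k =
      ασασ≡σσα G (¬Degree3⇒OnTriangle (proj₁ (proj₁ (hub-spoke (suc k))))) (rim-degree3 k)

    -- k + m is k - 1 modulo n.
    ασ-rim : ∀ k → α G (σ G (rim k)) ≡ σ G (σ G (rim (k + m)))
    ασ-rim k = trans (cong (α G ∘ σ G ∘ α G) (sym (hub-pred k))) (rim-edge (k + m))

    ασσ-rim : ∀ k → α G (σ G (σ G (rim k))) ≡ σ G (rim (suc k))
    ασσ-rim k = trans (cong (α G) (sym (rim-edge k))) (αα G _)

    data Position (x : Fin (d G)) : Set where
      at-hub : ∀ k → x ≡ hub k → Position x
      at-rim : ∀ k → Around G (rim k) x → Position x

    vertex : ∀ {x} → Position x → Fin (suc n)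
    vertex (at-hub _ _) = fzero
    vertex (at-rim k _) = fsuc (rimIndex k)

    Position-σ : ∀ {x} → Position x → Position (σ G x)
    Position-σ (at-hub k x≡hub) = at-hub (suc k) (cong (σ G) x≡hub)
    Position-σ (at-rim k at)    = at-rim k (Around-σ G (rim-degree3 k) at)

    vertex-σ : ∀ {x} (p : Position x) → vertex (Position-σ p) ≡ vertex p
    vertex-σ (at-hub _ _) = refl
    vertex-σ (at-rim _ _) = refl

    Position-α : ∀ {x} → Position x → Position (α G x)
    Position-α (at-hub k refl) = at-rim k at₀
    Position-α (at-rim k at₀)  = at-hub k (αα G _)
    Position-α (at-rim k at₁)  = at-rim (k + m) (subst (Around G _) (sym (ασ-rim k)) at₂)
    Position-α (at-rim k at₂)  = at-rim (suc k) (subst (Around G _) (sym (ασσ-rim k)) at₁)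

    position : ∀ x → Position x
    position = Connected-induction G connected {P = Position} Position-σ Position-α (at-hub 0 refl)

    hub≢rim : ∀ {x} k k′ → x ≡ hub k → Around G (rim k′) x → ⊥
    hub≢rim k k′ refl at = loopFree (hub k′)
      (SameOrbit-trans (hub-SameOrbit k′ k) (Around⇒SameOrbit⁻ G (rim-degree3 k′) at))

    rim-SameOrbit⇒rimIndex≡ : ∀ k k′ → SameOrbit (σ G) (rim k) (rim k′) → rimIndex k ≡ rimIndex k′
    rim-SameOrbit⇒rimIndex≡ k k′ rimk~rimk′ with rimIndex k Fin.≟ rimIndex k′
    ... | yes eq = eq
    ... | no neq = ⊥-elim (noMultiEdges (hub k) (hub k′) (neq ∘ hub≡⇒rimIndex≡ k k′ ∘ sym)
                                        hubk′≢rimk (hub-SameOrbit k k′) rimk~rimk′)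
      where
      hubk′≢rimk : hub k′ ≢ rim k
      hubk′≢rimk hubk′≡rimk =
        loopFree (hub k) (subst (SameOrbit (σ G) (hub k)) hubk′≡rimk (hub-SameOrbit k k′))

    vertex-unique : ∀ {x} (p q : Position x) → vertex p ≡ vertex q
    vertex-unique (at-hub _ _)     (at-hub _ _)      = refl
    vertex-unique (at-hub k x≡hub) (at-rim k′ at)    = ⊥-elim (hub≢rim k k′ x≡hub at)
    vertex-unique (at-rim k at)    (at-hub k′ x≡hub) = ⊥-elim (hub≢rim k′ k x≡hub at)
    vertex-unique (at-rim k at)    (at-rim k′ at′)   = cong fsuc (rim-SameOrbit⇒rimIndex≡ k k′
      (SameOrbit-trans (Around⇒SameOrbit G at) (Around⇒SameOrbit⁻ G (rim-degree3 k′) at′)))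

    wheelVertex : Fin (d G) → Fin (suc n)
    wheelVertex x = vertex (position x)

    wheelVertex-position : ∀ {x} (p : Position x) → wheelVertex x ≡ vertex p
    wheelVertex-position = vertex-unique (position _)

    wheelVertex-iter : ∀ k x → wheelVertex (iter (σ G) k x) ≡ wheelVertex x
    wheelVertex-iter zero    x = refl
    wheelVertex-iter (suc k) x = begin
      wheelVertex (σ G (iter (σ G) k x))      ≡⟨ wheelVertex-position (Position-σ p) ⟩
      vertex (Position-σ p)                   ≡⟨ vertex-σ p ⟩
      wheelVertex (iter (σ G) k x)            ≡⟨ wheelVertex-iter k x ⟩
      wheelVertex x                           ∎
      where
      open ≡-Reasoning
      p : Position (iter (σ G) k x)
      p = position (iter (σ G) k x)

    vertex≡⇒SameOrbit : ∀ {x y} (p : Position x) (q : Position y) → vertex p ≡ vertex q →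
                         SameOrbit (σ G) x y
    vertex≡⇒SameOrbit (at-hub k refl) (at-hub k′ refl) _ = hub-SameOrbit k k′
    vertex≡⇒SameOrbit {y = y} (at-rim k at) (at-rim k′ at′) same = SameOrbit-trans
      (Around⇒SameOrbit⁻ G (rim-degree3 k) at)
      (subst (λ h → SameOrbit (σ G) (α G h) y) (sym (rimIndex≡⇒hub≡ k k′ (Fin.suc-injective same)))
        (Around⇒SameOrbit G at′))

    wheelVertex≡⇔SameOrbit : ∀ x y → (wheelVertex x ≡ wheelVertex y) ⇔ SameOrbit (σ G) x y
    wheelVertex≡⇔SameOrbit x y = mk⇔ (vertex≡⇒SameOrbit (position x) (position y))
                                     (λ { (k , refl) → sym (wheelVertex-iter k x) })

    wheelVertex-surjective : ∀ v → ∃ λ x → wheelVertex x ≡ v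
    wheelVertex-surjective fzero    = y₀ , wheelVertex-position (at-hub 0 refl)
    wheelVertex-surjective (fsuc i) = rim (toℕ i) ,
      trans (wheelVertex-position (at-rim (toℕ i) at₀)) (cong fsuc (toℕ-mod-toℕ n i))

    vertex-α-adjacent : ∀ {x} (p : Position x) → WheelAdj n (vertex p) (vertex (Position-α p))
    vertex-α-adjacent (at-hub k refl) = tt
    vertex-α-adjacent (at-rim k at₀)  = tt
    vertex-α-adjacent (at-rim k at₁)  =
      inj₂ (subst (NextRim n (rimIndex (k + m))) (rimIndex-pred k) (NextRim-mod n (k + m)))
    vertex-α-adjacent (at-rim k at₂)  = inj₁ (NextRim-mod n k)

    wheelVertex-α-adjacent : ∀ x → WheelAdj n (wheelVertex x) (wheelVertex (α G x))
    wheelVertex-α-adjacent x = subst (WheelAdj n (wheelVertex x))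
      (sym (wheelVertex-position (Position-α (position x)))) (vertex-α-adjacent (position x))

    rim-edge-realised : ∀ i j → NextRim n i j →
                        ∃ λ x → wheelVertex x ≡ fsuc i × wheelVertex (α G x) ≡ fsuc j
    rim-edge-realised i j next = σ G (σ G (rim (toℕ i))) ,
      trans (wheelVertex-position (at-rim (toℕ i) at₂)) (cong fsuc (toℕ-mod-toℕ n i)) ,
      trans (wheelVertex-position (Position-α (at-rim (toℕ i) at₂)))
            (cong fsuc (NextRim⇒suc-mod n next))

    WheelAdj⇒realised : ∀ i j → WheelAdj n i j →
                        ∃ λ x → wheelVertex x ≡ i × wheelVertex (α G x) ≡ j
    WheelAdj⇒realised fzero (fsuc j) _ = hub (toℕ j) ,
      wheelVertex-position (at-hub (toℕ j) refl) ,
      trans (wheelVertex-position (at-rim (toℕ j) at₀)) (cong fsuc (toℕ-mod-toℕ n j))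
    WheelAdj⇒realised (fsuc i) fzero _ = rim (toℕ i) ,
      trans (wheelVertex-position (at-rim (toℕ i) at₀)) (cong fsuc (toℕ-mod-toℕ n i)) ,
      wheelVertex-position (at-hub (toℕ i) (αα G _))
    WheelAdj⇒realised (fsuc i) (fsuc j) (inj₁ next) = rim-edge-realised i j next
    WheelAdj⇒realised (fsuc i) (fsuc j) (inj₂ next) with rim-edge-realised j i next
    ... | x , x↦j , αx↦i = α G x , αx↦i , trans (cong wheelVertex (αα G x)) x↦j

    isoToWheel : IsoToWheel G n
    isoToWheel = wheelVertex , wheelVertex≡⇔SameOrbit , wheelVertex-surjective ,
                 wheelVertex-α-adjacent , WheelAdj⇒realised

  wheel : Connected G → Simple G → (∀ x → σ G x ≢ x) → (∀ x → σ G (σ G x) ≢ x) →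
          ∀ {y₀} → WheelSpoke y₀ → Wheel G
  wheel connected simple σ≢id σσ≢id {y₀} spoke with orbitLength (σ-injective G) y₀
  ... | suc m , hub-degree = suc m , OrbitLen⇒3≤ (σ≢id y₀) (σσ≢id y₀) hub-degree ,
                             WheelFromSpoke.isoToWheel connected simple spoke m hub-degree

  cubic⊎triangulation⊎wheel : Connected G → Simple G → (∀ x → σ G x ≢ x) → (∀ x → σ G (σ G x) ≢ x) →
                              Cubic G ⊎ Triangulation G ⊎ Wheel G
  cubic⊎triangulation⊎wheel connected simple σ≢id σσ≢id with Fin.all? (period3? (σ G))
  ... | yes cubic = inj₁ (λ x → Period3⇒OrbitLen (cubic x))
  ... | no ¬cubic with Fin.any? wheelSpoke?
  ...   | yes (_ , spoke) = inj₂ (inj₂ (wheel connected simple σ≢id σσ≢id spoke))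
  ...   | no ¬spoke       = inj₂ (inj₁ (triangulation connected farTriangle (proj₂ not3)))
    where
    farTriangle : ∀ {y} → Spoke y → OnTriangle G (farDart y)
    farTriangle spoke = decidable-stable (period3? (φ G) _) (λ ¬tri → ¬spoke (_ , spoke , ¬tri))
    not3 : ∃ λ y → ¬ Degree3 G y
    not3 = Fin.¬∀⟶∃¬ _ _ (period3? (σ G)) ¬cubic

corollary8 : (D G : Map) → LinkGraph D → LuneFree D → Tight D →
    Simple G → PlaneGraph G → IsMedialOf D G →
    Cubic G ⊎ Triangulation G ⊎ Wheel G
corollary8 D G _ luneFree tight simple (connected , _) medial =
  cubic⊎triangulation⊎wheel connected simple (LuneFree⇒σ≢id luneFree) (LuneFree⇒σσ≢id luneFree)
  where
  open Medial D G medial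
  open DegreeOrTriangle G (Tight⇒Degree3⊎OnTriangle tight)
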